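{- Consider Algorithm 1 below run on an instance with an $\alpha$-estimation $\mathsf{opt}_\alpha$. If the algorithm selects a value $p$ and its output $S$ satisfies $|S|< |OPT_{p+3}|/[2(d+1)]$, then $f(S)\ge w(OPT_{p+3})/8$.
   Context: $\mathcal N$ is a finite ground set, $f:2^{\mathcal N}\to\mathbb R_{\ge0}$ is a monotone set function with $f(\varnothing)=0$, and $M=(\mathcal N,\mathcal I)$ is a matroid of rank $k$; $OPT$ is an independent set maximizing $f$. $f(u\mid S)=f(S\cup\{u\})-f(S)$. $\mathcal D^+(u)=\{v\in\mathcal N:\exists S\subseteq\mathcal N,\ f(u\mid S\cup\{v\})>f(u\mid S)\}$ and $d=\max_u|\mathcal D^+(u)|$ is the supermodular degree. Elements arrive in some order; $\mathcal N_u$ is the set of elements arriving up to and including $u$. $\alpha\ge1$ and $\mathsf{opt}_\alpha$ satisfies $f(OPT)/\alpha\le\mathsf{opt}_\alpha\le f(OPT)$. For $u\in OPT$, $w(u)=f(u\mid OPT\setminus\mathcal N_u)$, extended additively to subsets of $OPT$, and for every integer $p$, $OPT_p=\{u\in OPT:2^p\mathsf{opt}_\alpha/2\le w(u)\le 2^p\mathsf{opt}_\alpha\}$. Algorithm 1: choose $p$ uniformly at random from the integers $\{ -\lceil\log_2k\rceil-3,\dots,\lceil\log_2\alpha\rceil\}$; set $\tau=2^p\cdot\mathsf{opt}_\alpha/2$ and $S=\varnothing$; for each arriving element $u$ in order, if there is a set $D\subseteq\mathcal D^+(u)\setminus\mathcal N_u$ with $f(u\mid D\cup S)\ge\tau$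 and $S\cup D\cup\{u\}\in\mathcal I$, then add $D\cup\{u\}$ to $S$ (the elements of $D$ are accepted when they arrive); finally return $S$.
   Formalization: The set function f takes values in the nonnegative rationals, and the parameters α and $\mathsf{opt}_\alpha$ are rational. -}

module Defs where

open import Data.Nat as ℕ using (ℕ; zero; suc)
open import Data.Integer as ℤ using (ℤ; +_; -[1+_])
open import Data.Rational using (ℚ; 0ℚ; 1ℚ; _+_; _-_; _*_; _/_; ½; _≤_; _<_)
open import Data.Rational.Properties using (_≤?_)
open import Data.Fin using (Fin; toℕ)
import Data.Fin as Fin
open import Data.Fin.Subset using (Subset; _∈_; _∉_; _⊆_; _∪_; ⁅_⁆; ∣_∣; ⊥; inside; outside)
open import Data.Vec using (tabulate; lookup)
open import Data.List using (List; []; _∷_; allFin; map; foldr)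
open import Data.List as List using ()
open import Data.Bool using (Bool; true; false; _∧_; if_then_else_)
open import Data.Product using (Σ; ∃; _×_; _,_)
open import Relation.Binary.PropositionalEquality using (_≡_)
open import Relation.Nullary using (¬_; does)

SetFun : ℕ → Set
SetFun n = Subset n → ℚ

marg : ∀ {n} → SetFun n → Fin n → Subset n → ℚ
marg f u S = f (S ∪ ⁅ u ⁆) - f S

Monotone : ∀ {n} → SetFun n → Set
Monotone f = ∀ A B → A ⊆ B → f A ≤ f B

NonNeg : ∀ {n} → SetFun n → Set
NonNeg f = ∀ A → 0ℚ ≤ f A

record Matroid (n : ℕ) : Set₁ where
  field
    Indep    : Subset n → Set
    indep-⊥  : Indep ⊥
    indep-⊆  : ∀ A B → A ⊆ B → Indep B → Indep A
    exchange : ∀ A B → Indep A → Indep B → ∣ A ∣ ℕ.< ∣ B ∣ →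
               ∃ λ x → x ∈ B × x ∉ A × Indep (A ∪ ⁅ x ⁆)

HasRank : ∀ {n} → Matroid n → ℕ → Set
HasRank M k = (∃ λ B → Indep B × ∣ B ∣ ≡ k) × (∀ A → Indep A → ∣ A ∣ ℕ.≤ k)
  where open Matroid M

IsOPT : ∀ {n} → Matroid n → SetFun n → Subset n → Set
IsOPT M f O = Indep O × (∀ A → Indep A → f A ≤ f O)
  where open Matroid M

DPlus : ∀ {n} → SetFun n → Fin n → Fin n → Set
DPlus f u v = ∃ λ S → marg f u S < marg f u (S ∪ ⁅ v ⁆)

maxList : List ℕ → ℕ
maxList = foldr ℕ._⊔_ 0

IsSupDegree : ∀ {n} → SetFun n → ℕ → Set
IsSupDegree {n} f d = Σ (Fin n → Subset n) λ Dp →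
  (∀ u v → (v ∈ Dp u → DPlus f u v) × (DPlus f u v → v ∈ Dp u)) ×
  d ≡ maxList (map (λ u → ∣ Dp u ∣) (allFin n))

pow2ℕ : ℕ → ℚ
pow2ℕ zero    = 1ℚ
pow2ℕ (suc m) = (+ 2 / 1) * pow2ℕ m

pow2⁻ : ℕ → ℚ   -- pow2⁻ m = 2^-(m+1)
pow2⁻ zero    = ½
pow2⁻ (suc m) = ½ * pow2⁻ m

pow2 : ℤ → ℚ
pow2 (+ m)     = pow2ℕ m
pow2 -[1+ m ]  = pow2⁻ m

IsCeilLog2 : ℚ → ℤ → Set
IsCeilLog2 x a = pow2 (a ℤ.- ℤ.+ 1) < x × x ≤ pow2 a

-- N_u: elements arriving up to and including u (arrival order = index order)
-- w(u) = f(u | OPT \ N_u)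
NotArrivedBy : ∀ {n} → Fin n → Subset n
NotArrivedBy {n} u = tabulate λ v → if does (toℕ u ℕ.<? toℕ v) then inside else outside

weight : ∀ {n} → SetFun n → Subset n → Fin n → ℚ
weight f O u = marg f u (O Data.Fin.Subset.∩ NotArrivedBy u)

sumOver : ∀ {n} → Subset n → (Fin n → ℚ) → ℚ
sumOver {n} T g = foldr (λ u acc → if lookup T u ≡ᵇ inside then g u + acc else acc) 0ℚ (allFin n)
  where
    _≡ᵇ_ : Bool → Bool → Bool
    true ≡ᵇ b = b
    false ≡ᵇ true = false
    false ≡ᵇ false = true

OPTp : ∀ {n} → SetFun n → Subset n → ℚ → ℤ → Subset n
OPTp f O opt p = tabulate λ u →
  lookup O u ∧ does (pow2 p * opt * ½ ≤? weight f O u) ∧ does (weight f O u ≤? pow2 p * opt)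

ValidD : ∀ {n} → Matroid n → SetFun n → ℚ → Subset n → Fin n → Subset n → Set
ValidD M f τ S u D =
  (∀ v → v ∈ D → DPlus f u v × u Fin.< v) ×
  τ ≤ marg f u (D ∪ S) ×
  Matroid.Indep M (S ∪ D ∪ ⁅ u ⁆)

data Step {n} (M : Matroid n) (f : SetFun n) (τ : ℚ) (S : Subset n) (u : Fin n) : Subset n → Set where
  accept : ∀ D → ValidD M f τ S u D → Step M f τ S u (S ∪ D ∪ ⁅ u ⁆)
  skip   : (¬ ∃ λ D → ValidD M f τ S u D) → Step M f τ S u S

data Run {n} (M : Matroid n) (f : SetFun n) (τ : ℚ) : List (Fin n) → Subset n → Subset n → Set where
  done : ∀ {S} → Run M f τ [] S S
  step : ∀ {u us S S' S''} → Step M f τ S u S' → Run M f τ us S' S'' → Run M f τ (u ∷ us) S S''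

Output : ∀ {n} → Matroid n → SetFun n → ℚ → ℤ → Subset n → Set
Output {n} M f opt p S = Run M f (pow2 p * opt * ½) (allFin n) ⊥ S

-- Let τ = 2^p·opt_α/2, so that T = OPT_{p+3} consists of elements of weight between 8τ and 16τ.
-- By matroid exchange, S extends by some B ⊆ OPT ∖ S to an independent S ∪ B with
-- |OPT ∖ B| ≤ |S|. Call u ∈ T settled if u ∈ B and no element of D⁺(u) ∩ OPT is missing from B.
-- As D⁺ is symmetric, an unsettled u lies in OPT ∖ B or in its D⁺-neighbourhood, so at least
-- |T| − (d+1)|S| elements of T are settled.
-- Now add the elements e of B to S from the largest down, and let B_e = {v ∈ B : v > e}.
-- Every marginal f(e | S ∪ B_e) is below τ: when e arrived, the elements of D⁺(e) ∩ (S ∪ B_e)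
-- not yet seen formed an admissible D, which the algorithm rejected. For settled e,
-- f(e | B_e) ≥ w(e) ≥ 8τ; for every e, f(e | S ∪ B_e) ≤ f(e | B_e) + τ, and unless e is one of
-- the ≤ d|S| neighbours of S even f(e | S ∪ B_e) ≤ f(e | B_e). Telescoping over B gives
-- 7τ·#settled ≤ f(S) + dτ|S|, which with the count of settled elements yields 2τ|T| ≤ f(S),
-- while w(T)/8 ≤ 2τ|T|.
module Submission where

open import Defs
open import Data.Nat using (ℕ; suc; _*_)
open import Data.Nat as ℕ using ()
open import Data.Integer as ℤ using (ℤ; +_)
open import Data.Rational using (ℚ; 0ℚ; 1ℚ; _≤_; _/_)
open import Data.Rational as ℚ using ()
open import Data.Fin.Subset using (Subset; ∣_∣)
open import Data.Product using (_×_)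
open import Relation.Binary.PropositionalEquality using (_≡_)

open import Data.Rational.Properties as ℚ using ()
open import Algebra.Bundles using (Ring)
open import Algebra.Definitions.RawMonoid ℚ.+-0-rawMonoid using () renaming (_×_ to _·_)
open import Algebra.Properties.Monoid.Mult ℚ.+-0-monoid using (×-homo-+; ×-assocˡ)
open import Algebra.Properties.Semiring.Mult (Ring.semiring ℚ.+-*-ring) using (×-assoc-*; ×-comm-*)
open import Data.Bool using (true; false; if_then_else_; _∧_)
open import Data.Fin as Fin using (Fin; zero; suc; toℕ)
open import Data.Fin.Properties using (any?)
open import Data.Fin.Subset using (⊥; ⊤; ⁅_⁆; _∪_; _∩_; _∈_; _∉_; _⊆_; Nonempty; inside; outside)
open import Data.Fin.Subset.Properties
open import Data.Integer.Properties as ℤ using ()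
open import Data.List using (List; allFin; foldr)
open import Data.List.Membership.Propositional as List using ()
open import Data.List.Membership.Propositional.Properties using (∈-allFin; ∈-map⁺)
open import Data.List.Properties using (map-tabulate; foldr-map; foldr-preservesᵒ)
open import Data.List.Relation.Unary.All using (All)
open import Data.List.Relation.Unary.AllPairs using (AllPairs)
open import Data.List.Relation.Unary.AllPairs.Properties using (tabulate⁺-<)
open import Data.List.Relation.Unary.Any as Any using ()
import Data.Nat.Properties as ℕ
import Data.Nat.Solver as ℕ-Solver
open import Data.Product using (∃; _,_; proj₁; proj₂)
open import Data.Rational using (_+_; _-_; _<_; ½)
open import Data.Rational.Solver using (module +-*-Solver)
open import Data.Sum using (inj₁; inj₂; [_,_]′)
open import Data.Vec using (_∷_; []; here; there; lookup; tabulate)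
open import Data.Vec.Properties using (lookup∘tabulate; lookup⇒[]=; []=⇒lookup; tabulate-cong)
open import Function using (_∘_; id)
open import Level using (Level)
open import Relation.Binary.PropositionalEquality
  using (refl; sym; trans; cong; cong₂; subst; subst₂; module ≡-Reasoning)
open import Relation.Nullary using (¬_; Dec; yes; no; does; contradiction)
open import Relation.Nullary.Decidable using (dec-true; _×-dec_; ¬?)
open import Relation.Unary using (Pred; Decidable)

private
  variable
    ℓ : Level
    n : ℕ
    x y : Fin n
    p q r : Subset n
    us : List (Fin n)

-- Subsets of Fin n

subset : {P : Pred (Fin n) ℓ} → Decidable P → Subset n
subset P? = tabulate (does ∘ P?)

module _ {P : Pred (Fin n) ℓ} (P? : Decidable P) where

  ∈-subset⁺ : P x → x ∈ subset P?
  ∈-subset⁺ {x} px = lookup⇒[]= x _ (trans (lookup∘tabulate _ x) (dec-true (P? x) px))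

  ∈-subset⁻ : x ∈ subset P? → P x
  ∈-subset⁻ {x} x∈ with P? x | trans (sym (lookup∘tabulate (does ∘ P?) x)) ([]=⇒lookup x∈)
  ... | yes px | _  = px
  ... | no  _  | ()

does-∈? : ∀ (x : Fin n) p → does (x ∈? p) ≡ lookup p x
does-∈? zero    (inside ∷ p)  = refl
does-∈? zero    (outside ∷ p) = refl
does-∈? (suc x) (_ ∷ p)       = does-∈? x p

∪-lub : p ⊆ r → q ⊆ r → p ∪ q ⊆ r
∪-lub {p = p} {q = q} p⊆r q⊆r x∈ = [ p⊆r , q⊆r ]′ (x∈p∪q⁻ p q x∈)

⁅x⁆⊆p : x ∈ p → ⁅ x ⁆ ⊆ p
⁅x⁆⊆p {x = x} {p} x∈p y∈⁅x⁆ = subst (_∈ p) (sym (x∈⁅y⁆⇒x≡y x y∈⁅x⁆)) x∈p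

p∪⁅x⁆≡p : x ∈ p → p ∪ ⁅ x ⁆ ≡ p
p∪⁅x⁆≡p x∈p = ⊆-antisym (∪-lub id (⁅x⁆⊆p x∈p)) (p⊆p∪q _)

p⊆q⇒p∪q≡q : p ⊆ q → p ∪ q ≡ q
p⊆q⇒p∪q≡q {p = p} {q} p⊆q = ⊆-antisym (∪-lub p⊆q id) (q⊆p∪q p q)

⁅x⁆∩p≡⁅x⁆ : x ∈ p → ⁅ x ⁆ ∩ p ≡ ⁅ x ⁆
⁅x⁆∩p≡⁅x⁆ {x = x} {p} x∈p = ⊆-antisym (p∩q⊆p ⁅ x ⁆ p) (λ y∈⁅x⁆ → x∈p∩q⁺ (y∈⁅x⁆ , ⁅x⁆⊆p x∈p y∈⁅x⁆))

⁅x⁆∩p≡⊥ : x ∉ p → ⁅ x ⁆ ∩ p ≡ ⊥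
⁅x⁆∩p≡⊥ {x = x} {p} x∉p = ⊆-antisym
  (λ y∈ → let y∈⁅x⁆ , y∈p = x∈p∩q⁻ ⁅ x ⁆ p y∈ in contradiction (subst (_∈ p) (x∈⁅y⁆⇒x≡y x y∈⁅x⁆) y∈p) x∉p)
  (⊆-min _)

∣p∪q∣≤∣p∣+∣q∣ : ∀ (p q : Subset n) → ∣ p ∪ q ∣ ℕ.≤ ∣ p ∣ ℕ.+ ∣ q ∣
∣p∪q∣≤∣p∣+∣q∣ []            []            = ℕ.z≤n
∣p∪q∣≤∣p∣+∣q∣ (outside ∷ p) (outside ∷ q) = ∣p∪q∣≤∣p∣+∣q∣ p q
∣p∪q∣≤∣p∣+∣q∣ (outside ∷ p) (inside ∷ q)  =
  ℕ.≤-trans (ℕ.s≤s (∣p∪q∣≤∣p∣+∣q∣ p q)) (ℕ.≤-reflexive (sym (ℕ.+-suc ∣ p ∣ ∣ q ∣)))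
∣p∪q∣≤∣p∣+∣q∣ (inside ∷ p)  (outside ∷ q) = ℕ.s≤s (∣p∪q∣≤∣p∣+∣q∣ p q)
∣p∪q∣≤∣p∣+∣q∣ (inside ∷ p)  (inside ∷ q)  =
  ℕ.s≤s (ℕ.≤-trans (∣p∪q∣≤∣p∣+∣q∣ p q) (ℕ.+-monoʳ-≤ ∣ p ∣ (ℕ.n≤1+n ∣ q ∣)))

private
  drop-disjoint : ∀ {s t} → (∀ {x} → x ∈ s ∷ p → x ∉ t ∷ q) → (∀ {x} → x ∈ p → x ∉ q)
  drop-disjoint disjoint x∈p x∈q = disjoint (there x∈p) (there x∈q)

∣p∪q∣≡∣p∣+∣q∣ : ∀ (p q : Subset n) → (∀ {x} → x ∈ p → x ∉ q) → ∣ p ∪ q ∣ ≡ ∣ p ∣ ℕ.+ ∣ q ∣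
∣p∪q∣≡∣p∣+∣q∣ []            []            _        = refl
∣p∪q∣≡∣p∣+∣q∣ (outside ∷ p) (outside ∷ q) disjoint = ∣p∪q∣≡∣p∣+∣q∣ p q (drop-disjoint disjoint)
∣p∪q∣≡∣p∣+∣q∣ (outside ∷ p) (inside ∷ q)  disjoint =
  trans (cong suc (∣p∪q∣≡∣p∣+∣q∣ p q (drop-disjoint disjoint))) (sym (ℕ.+-suc ∣ p ∣ ∣ q ∣))
∣p∪q∣≡∣p∣+∣q∣ (inside ∷ p)  (outside ∷ q) disjoint =
  cong suc (∣p∪q∣≡∣p∣+∣q∣ p q (drop-disjoint disjoint))
∣p∪q∣≡∣p∣+∣q∣ (inside ∷ p)  (inside ∷ q)  disjoint = contradiction here (disjoint here)

∣p∪⁅x⁆∣≡1+∣p∣ : x ∉ p → ∣ p ∪ ⁅ x ⁆ ∣ ≡ suc ∣ p ∣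
∣p∪⁅x⁆∣≡1+∣p∣ {x = x} {p} x∉p = begin
  ∣ p ∪ ⁅ x ⁆ ∣        ≡⟨ ∣p∪q∣≡∣p∣+∣q∣ p ⁅ x ⁆ (λ y∈p y∈⁅x⁆ → x∉p (subst (_∈ p) (x∈⁅y⁆⇒x≡y x y∈⁅x⁆) y∈p)) ⟩
  ∣ p ∣ ℕ.+ ∣ ⁅ x ⁆ ∣  ≡⟨ cong (∣ p ∣ ℕ.+_) (∣⁅x⁆∣≡1 x) ⟩
  ∣ p ∣ ℕ.+ 1          ≡⟨ ℕ.+-comm ∣ p ∣ 1 ⟩
  suc ∣ p ∣            ∎
  where open ≡-Reasoning

∣[p∪⁅x⁆]∩q∣≡∣p∩q∣+∣⁅x⁆∩q∣ : x ∉ p → ∀ q → ∣ (p ∪ ⁅ x ⁆) ∩ q ∣ ≡ ∣ p ∩ q ∣ ℕ.+ ∣ ⁅ x ⁆ ∩ q ∣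
∣[p∪⁅x⁆]∩q∣≡∣p∩q∣+∣⁅x⁆∩q∣ {x = x} {p} x∉p q =
  trans (cong ∣_∣ (∩-distribʳ-∪ q p ⁅ x ⁆)) (∣p∪q∣≡∣p∣+∣q∣ (p ∩ q) (⁅ x ⁆ ∩ q) disjoint)
  where
  disjoint : ∀ {y} → y ∈ p ∩ q → y ∉ ⁅ x ⁆ ∩ q
  disjoint y∈p∩q y∈⁅x⁆∩q =
    x∉p (subst (_∈ p) (x∈⁅y⁆⇒x≡y x (proj₁ (x∈p∩q⁻ ⁅ x ⁆ q y∈⁅x⁆∩q))) (proj₁ (x∈p∩q⁻ p q y∈p∩q)))

∣⊥∩p∣≡0 : ∀ (p : Subset n) → ∣ ⊥ ∩ p ∣ ≡ 0
∣⊥∩p∣≡0 {n} p = trans (cong ∣_∣ (∩-zeroˡ p)) (∣⊥∣≡0 n)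

∣⁅x⁆∩p∣≡1 : x ∈ p → ∣ ⁅ x ⁆ ∩ p ∣ ≡ 1
∣⁅x⁆∩p∣≡1 {x = x} x∈p = trans (cong ∣_∣ (⁅x⁆∩p≡⁅x⁆ x∈p)) (∣⁅x⁆∣≡1 x)

∣⁅x⁆∩p∣≡0 : x ∉ p → ∣ ⁅ x ⁆ ∩ p ∣ ≡ 0
∣⁅x⁆∩p∣≡0 {n} x∉p = trans (cong ∣_∣ (⁅x⁆∩p≡⊥ x∉p)) (∣⊥∣≡0 n)

Above : Fin n → Subset n
Above zero    = outside ∷ ⊤
Above (suc x) = outside ∷ Above x

∈-Above⁺ : x Fin.< y → y ∈ Above x
∈-Above⁺ {x = zero}  {suc y} _           = there ∈⊤
∈-Above⁺ {x = suc x} {suc y} (ℕ.s≤s x<y) = there (∈-Above⁺ x<y)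

∈-Above⁻ : y ∈ Above x → x Fin.< y
∈-Above⁻ {y = suc y} {zero}  (there _)  = ℕ.s≤s ℕ.z≤n
∈-Above⁻ {y = suc y} {suc x} (there y∈) = ℕ.s≤s (∈-Above⁻ y∈)

x∉p∩Above[x] : x ∉ p ∩ Above x
x∉p∩Above[x] {x = x} {p = p} x∈ = ℕ.<-irrefl refl (∈-Above⁻ (proj₂ (x∈p∩q⁻ p (Above x) x∈)))

NotArrivedBy≡Above : ∀ (x : Fin n) → NotArrivedBy x ≡ Above x
NotArrivedBy≡Above x = ⊆-antisym
  (λ {y} y∈ → ∈-Above⁺ (∈-subset⁻ later? (subst (y ∈_) NotArrivedBy≡subset y∈)))
  (λ {y} y∈ → subst (y ∈_) (sym NotArrivedBy≡subset) (∈-subset⁺ later? (∈-Above⁻ y∈)))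
  where
  later? : Decidable (x Fin.<_)
  later? y = toℕ x ℕ.<? toℕ y
  if-id : ∀ b → (if b then inside else outside) ≡ b
  if-id true  = refl
  if-id false = refl
  NotArrivedBy≡subset : NotArrivedBy x ≡ subset later?
  NotArrivedBy≡subset = tabulate-cong λ y → if-id (does (later? y))

∩-Above-ind : (P : Subset n → Set ℓ) (Y : Subset n) → P ⊥ →
              (∀ e → e ∈ Y → P (Y ∩ Above e) → P (Y ∩ Above e ∪ ⁅ e ⁆)) → P Y
∩-Above-ind {ℕ.zero} P []            P⊥ _      = P⊥
∩-Above-ind {suc n}  P (outside ∷ Y) P⊥ extend =
  ∩-Above-ind (P ∘ (outside ∷_)) Y P⊥ (λ e e∈Y → extend (suc e) (there e∈Y))
∩-Above-ind {suc n}  P (inside ∷ Y)  P⊥ extend =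
  subst (P ∘ (inside ∷_)) (trans (∪-identityʳ _) (∩-identityʳ Y))
    (extend zero here (subst (P ∘ (outside ∷_)) (sym (∩-identityʳ Y)) tail))
  where
  tail : P (outside ∷ Y)
  tail = ∩-Above-ind (P ∘ (outside ∷_)) Y P⊥ (λ e e∈Y → extend (suc e) (there e∈Y))

-- Rational arithmetic

p-q<r-s⇒s-q<r-p : ∀ p q r s → p - q < r - s → s - q < r - p
p-q<r-s⇒s-q<r-p p q r s h = subst₂ _<_
  (solve 4 (λ p q r s → (p :- q) :+ (s :- p) := s :- q) refl p q r s)
  (solve 4 (λ p q r s → (r :- s) :+ (s :- p) := r :- p) refl p q r s)
  (ℚ.+-monoˡ-< (s - p) h)
  where open +-*-Solver

+-cancelʳ-≤ : ∀ p q r → p + r ≤ q + r → p ≤ q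
+-cancelʳ-≤ p q r h = subst₂ _≤_ (cancel p) (cancel q) (ℚ.+-monoˡ-≤ (ℚ.- r) h)
  where
  open +-*-Solver
  cancel : ∀ p → (p + r) + ℚ.- r ≡ p
  cancel p = solve 2 (λ p r → (p :+ r) :+ (:- r) := p) refl p r

p≤q⇒0≤q-p : ∀ {p q} → p ≤ q → 0ℚ ≤ q - p
p≤q⇒0≤q-p {p} {q} h = subst (_≤ q - p) (ℚ.+-inverseʳ p) (ℚ.+-monoˡ-≤ (ℚ.- p) h)

p≤p+q : ∀ {p q} → 0ℚ ≤ q → p ≤ p + q
p≤p+q {p} 0≤q = subst (_≤ p + _) (ℚ.+-identityʳ p) (ℚ.+-monoʳ-≤ p 0≤q)

*-nonNeg : ∀ {p q} → 0ℚ ≤ p → 0ℚ ≤ q → 0ℚ ≤ p ℚ.* q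
*-nonNeg {p} {q} 0≤p 0≤q =
  ℚ.nonNegative⁻¹ _ {{ℚ.nonNeg*nonNeg⇒nonNeg p {{ℚ.nonNegative 0≤p}} q {{ℚ.nonNegative 0≤q}}}}

telescope-step : ∀ a x s z b δa x′ z′ δb →
                 a + x ≤ s + z + b → δa + (x′ - x) ≤ (z′ - z) + δb →
                 (a + δa) + x′ ≤ s + z′ + (b + δb)
telescope-step a x s z b δa x′ z′ δb old new = subst₂ _≤_
  (solve 5 (λ a x δa x′ s → (a :+ x) :+ (δa :+ (x′ :- x)) := (a :+ δa) :+ x′) refl a x δa x′ s)
  (solve 6 (λ s z b z′ δb x → (s :+ z :+ b) :+ ((z′ :- z) :+ δb) := s :+ z′ :+ (b :+ δb))
     refl s z b z′ δb x)
  (ℚ.+-mono-≤ old new)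
  where open +-*-Solver

·-nonNeg : ∀ m {x} → 0ℚ ≤ x → 0ℚ ≤ m · x
·-nonNeg ℕ.zero  _   = ℚ.≤-refl
·-nonNeg (suc m) 0≤x = ℚ.+-mono-≤ 0≤x (·-nonNeg m 0≤x)

·-monoˡ-≤ : ∀ {x} → 0ℚ ≤ x → ∀ {m m′} → m ℕ.≤ m′ → m · x ≤ m′ · x
·-monoˡ-≤     0≤x {m′ = m′} ℕ.z≤n = ·-nonNeg m′ 0≤x
·-monoˡ-≤ {x} 0≤x (ℕ.s≤s m≤m′)     = ℚ.+-monoʳ-≤ x (·-monoˡ-≤ 0≤x m≤m′)

estimate-nonNeg : ∀ {α o F} → 1ℚ ≤ α → 0ℚ ≤ F → F ≤ α ℚ.* o → 0ℚ ≤ o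
estimate-nonNeg {α} {o} 1≤α 0≤F F≤αo with ℚ.≤-total 0ℚ o
... | inj₁ 0≤o = 0≤o
... | inj₂ o≤0 = ℚ.≤-trans 0≤F (ℚ.≤-trans F≤αo
                   (subst (α ℚ.* o ≤_) (ℚ.*-identityˡ o) (ℚ.*-monoʳ-≤-nonPos o {{ℚ.nonPositive o≤0}} 1≤α)))

-- Powers of two, weight sums and OPT_p

pow2-+1 : ∀ q → pow2 (q ℤ.+ + 1) ≡ 2 · pow2 q
pow2-+1 (+ m)            = trans (cong pow2ℕ (ℕ.+-comm m 1))
                             (trans (×-assoc-* 2 1ℚ (pow2ℕ m)) (cong (2 ·_) (ℚ.*-identityˡ (pow2ℕ m))))
pow2-+1 ℤ.-[1+ ℕ.zero ]  = refl
pow2-+1 ℤ.-[1+ suc m ]   = sym (trans (sym (×-assoc-* 2 ½ (pow2⁻ m))) (ℚ.*-identityˡ (pow2⁻ m)))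

pow2-+ : ∀ q m → pow2 (q ℤ.+ + m) ≡ (2 ℕ.^ m) · pow2 q
pow2-+ q ℕ.zero  = trans (cong pow2 (ℤ.+-identityʳ q)) (sym (ℚ.+-identityʳ (pow2 q)))
pow2-+ q (suc m) = begin
  pow2 (q ℤ.+ + suc m)        ≡⟨ cong pow2 (trans (cong (ℤ._+_ q) (ℤ.+-comm (+ 1) (+ m)))
                                                  (sym (ℤ.+-assoc q (+ m) (+ 1)))) ⟩
  pow2 ((q ℤ.+ + m) ℤ.+ + 1)  ≡⟨ pow2-+1 (q ℤ.+ + m) ⟩
  2 · pow2 (q ℤ.+ + m)        ≡⟨ cong (2 ·_) (pow2-+ q m) ⟩
  2 · ((2 ℕ.^ m) · pow2 q)    ≡⟨ ×-assocˡ (pow2 q) 2 (2 ℕ.^ m) ⟩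
  (2 ℕ.^ suc m) · pow2 q      ∎
  where open ≡-Reasoning

pow2-nonNeg : ∀ q → 0ℚ ≤ pow2 q
pow2-nonNeg (+ ℕ.zero)       = ℚ.nonNegative⁻¹ 1ℚ
pow2-nonNeg (+ suc m)        = *-nonNeg (ℚ.nonNegative⁻¹ _) (pow2-nonNeg (+ m))
pow2-nonNeg ℤ.-[1+ ℕ.zero ]  = ℚ.nonNegative⁻¹ ½
pow2-nonNeg ℤ.-[1+ suc m ]   = *-nonNeg (ℚ.nonNegative⁻¹ ½) (pow2-nonNeg ℤ.-[1+ m ])

module _ (p : ℤ) (o : ℚ) where

  lower-threshold : pow2 (p ℤ.+ + 3) ℚ.* o ℚ.* ½ ≡ 8 · (pow2 p ℚ.* o ℚ.* ½)
  lower-threshold = begin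
    pow2 (p ℤ.+ + 3) ℚ.* o ℚ.* ½  ≡⟨ cong (λ z → z ℚ.* o ℚ.* ½) (pow2-+ p 3) ⟩
    (8 · pow2 p) ℚ.* o ℚ.* ½      ≡⟨ cong (ℚ._* ½) (×-assoc-* 8 (pow2 p) o) ⟩
    8 · (pow2 p ℚ.* o) ℚ.* ½      ≡⟨ ×-assoc-* 8 (pow2 p ℚ.* o) ½ ⟩
    8 · (pow2 p ℚ.* o ℚ.* ½)      ∎
    where open ≡-Reasoning

  upper-threshold/8 : pow2 (p ℤ.+ + 3) ℚ.* o ℚ.* (+ 1 / 8) ≡ 2 · (pow2 p ℚ.* o ℚ.* ½)
  upper-threshold/8 = begin
    pow2 (p ℤ.+ + 3) ℚ.* o ℚ.* (+ 1 / 8)  ≡⟨ cong (λ z → z ℚ.* o ℚ.* (+ 1 / 8)) (pow2-+ p 3) ⟩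
    (8 · pow2 p) ℚ.* o ℚ.* (+ 1 / 8)      ≡⟨ cong (ℚ._* (+ 1 / 8)) (×-assoc-* 8 (pow2 p) o) ⟩
    8 · (pow2 p ℚ.* o) ℚ.* (+ 1 / 8)      ≡⟨ ×-assoc-* 8 (pow2 p ℚ.* o) (+ 1 / 8) ⟩
    8 · (pow2 p ℚ.* o ℚ.* (+ 1 / 8))      ≡⟨ ×-comm-* 8 (pow2 p ℚ.* o) (+ 1 / 8) ⟨
    pow2 p ℚ.* o ℚ.* (8 · (+ 1 / 8))      ≡⟨⟩
    pow2 p ℚ.* o ℚ.* (2 · ½)              ≡⟨ ×-comm-* 2 (pow2 p ℚ.* o) ½ ⟩
    2 · (pow2 p ℚ.* o ℚ.* ½)              ∎
    where open ≡-Reasoning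

sumOver-∷ : ∀ b (p : Subset n) g →
            sumOver (b ∷ p) g ≡ (if b then g zero + sumOver p (g ∘ suc) else sumOver p (g ∘ suc))
sumOver-∷ {n} inside  p g = cong (_+_ (g zero))
  (trans (cong (foldr _ 0ℚ) (sym (map-tabulate {n = n} id suc))) (foldr-map _ suc 0ℚ (allFin n)))
sumOver-∷ {n} outside p g =
  trans (cong (foldr _ 0ℚ) (sym (map-tabulate {n = n} id suc))) (foldr-map _ suc 0ℚ (allFin n))

sumOver-≤ : ∀ (p : Subset n) g {c} → (∀ {x} → x ∈ p → g x ≤ c) → sumOver p g ≤ ∣ p ∣ · c
sumOver-≤ []            g bound = ℚ.≤-refl
sumOver-≤ (inside ∷ p)  g bound = subst (_≤ _) (sym (sumOver-∷ inside p g))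
  (ℚ.+-mono-≤ (bound here) (sumOver-≤ p (g ∘ suc) (bound ∘ there)))
sumOver-≤ (outside ∷ p) g bound = subst (_≤ _) (sym (sumOver-∷ outside p g))
  (sumOver-≤ p (g ∘ suc) (bound ∘ there))

module _ (f : SetFun n) (O : Subset n) (opt : ℚ) (p : ℤ) where

  ∈-OPTp⁻ : x ∈ OPTp f O opt p →
            x ∈ O × pow2 p ℚ.* opt ℚ.* ½ ≤ weight f O x × weight f O x ≤ pow2 p ℚ.* opt
  ∈-OPTp⁻ {x} x∈ = ∈-subset⁻ in-OPTp? (subst (x ∈_) OPTp≡subset x∈)
    where
    in-band? : ∀ u → Dec (pow2 p ℚ.* opt ℚ.* ½ ≤ weight f O u × weight f O u ≤ pow2 p ℚ.* opt)
    in-band? u = pow2 p ℚ.* opt ℚ.* ½ ℚ.≤? weight f O u ×-dec weight f O u ℚ.≤? pow2 p ℚ.* opt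
    in-OPTp? : Decidable (λ u → u ∈ O × pow2 p ℚ.* opt ℚ.* ½ ≤ weight f O u × weight f O u ≤ pow2 p ℚ.* opt)
    in-OPTp? u = u ∈? O ×-dec in-band? u
    OPTp≡subset : OPTp f O opt p ≡ subset in-OPTp?
    OPTp≡subset = tabulate-cong λ u → cong (_∧ does (in-band? u)) (sym (does-∈? u O))

≤-maxList : ∀ {m ms} → m List.∈ ms → m ℕ.≤ maxList ms
≤-maxList {m} m∈ms = foldr-preservesᵒ {P = m ℕ.≤_} (λ x y → [ ℕ.m≤n⇒m≤n⊔o y , ℕ.m≤n⇒m≤o⊔n x ]′)
                       0 _ (inj₂ (Any.map ℕ.≤-reflexive m∈ms))

-- Marginal values and the supermodular degree

module _ (f : SetFun n) where

  DPlus-sym : DPlus f x y → DPlus f y x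
  DPlus-sym {x = x} {y} (A , gain) =
    A , subst (λ B → f (A ∪ ⁅ y ⁆) - f A < f B - f (A ∪ ⁅ x ⁆)) ∪-swap
          (p-q<r-s⇒s-q<r-p (f (A ∪ ⁅ x ⁆)) (f A) (f ((A ∪ ⁅ y ⁆) ∪ ⁅ x ⁆)) (f (A ∪ ⁅ y ⁆)) gain)
    where
    ∪-swap : (A ∪ ⁅ y ⁆) ∪ ⁅ x ⁆ ≡ (A ∪ ⁅ x ⁆) ∪ ⁅ y ⁆
    ∪-swap = trans (∪-assoc A ⁅ y ⁆ ⁅ x ⁆)
               (trans (cong (A ∪_) (∪-comm ⁅ y ⁆ ⁅ x ⁆)) (sym (∪-assoc A ⁅ x ⁆ ⁅ y ⁆)))

  marg-nonNeg : Monotone f → ∀ x p → 0ℚ ≤ marg f x p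
  marg-nonNeg mono x p = p≤q⇒0≤q-p (mono p (p ∪ ⁅ x ⁆) (p⊆p∪q ⁅ x ⁆))

  marg-antitone : p ⊆ q → (∀ {y} → y ∈ q → y ∉ p → ¬ DPlus f x y) → marg f x q ≤ marg f x p
  marg-antitone {p = p} {q} {x} p⊆q independent =
    subst (λ r → marg f x r ≤ marg f x p) (p⊆q⇒p∪q≡q p⊆q)
      (∩-Above-ind (λ r → marg f x (p ∪ r) ≤ marg f x p) q
        (ℚ.≤-reflexive (cong (marg f x) (∪-identityʳ p))) extend)
    where
    extend : ∀ e → e ∈ q → marg f x (p ∪ q ∩ Above e) ≤ marg f x p →
             marg f x (p ∪ (q ∩ Above e ∪ ⁅ e ⁆)) ≤ marg f x p
    extend e e∈q ih with e ∈? p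
    ... | yes e∈p = subst (λ r → marg f x r ≤ marg f x p)
                      (trans (sym (p∪⁅x⁆≡p (p⊆p∪q (q ∩ Above e) e∈p))) (∪-assoc p _ ⁅ e ⁆)) ih
    ... | no  e∉p = subst (λ r → marg f x r ≤ marg f x p) (∪-assoc p _ ⁅ e ⁆)
                      (ℚ.≤-trans (ℚ.≮⇒≥ λ gain → independent e∈q e∉p (_ , gain)) ih)

module Neighbourhood (D : Fin n → Subset n) where

  neighbour? : ∀ X → Decidable (λ y → ∃ λ x → x ∈ X × y ∈ D x)
  neighbour? X y = any? (λ x → x ∈? X ×-dec y ∈? D x)

  neighbours : Subset n → Subset n
  neighbours X = subset (neighbour? X)

  ∈-neighbours⁺ : ∀ {X} → x ∈ X → y ∈ D x → y ∈ neighbours X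
  ∈-neighbours⁺ {x = x} {X = X} x∈X y∈Dx = ∈-subset⁺ (neighbour? X) (x , x∈X , y∈Dx)

  ∈-neighbours⁻ : ∀ {X} → y ∈ neighbours X → ∃ λ x → x ∈ X × y ∈ D x
  ∈-neighbours⁻ {X = X} = ∈-subset⁻ (neighbour? X)

  ∣neighbours∣≤ : ∀ {d} → (∀ x → ∣ D x ∣ ℕ.≤ d) → ∀ X → ∣ neighbours X ∣ ℕ.≤ d * ∣ X ∣
  ∣neighbours∣≤ {d} ∣D∣≤d X = ∩-Above-ind (λ Z → ∣ neighbours Z ∣ ℕ.≤ d * ∣ Z ∣) X base extend
    where
    base : ∣ neighbours ⊥ ∣ ℕ.≤ d * ∣ ⊥ {n} ∣
    base = ℕ.≤-trans (p⊆q⇒∣p∣≤∣q∣ {q = ⊥} (λ y∈ → contradiction (proj₁ (proj₂ (∈-neighbours⁻ y∈))) ∉⊥))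
             (ℕ.≤-trans (ℕ.≤-reflexive (∣⊥∣≡0 n)) ℕ.z≤n)
    extend : ∀ e → e ∈ X → ∣ neighbours (X ∩ Above e) ∣ ℕ.≤ d * ∣ X ∩ Above e ∣ →
             ∣ neighbours (X ∩ Above e ∪ ⁅ e ⁆) ∣ ℕ.≤ d * ∣ X ∩ Above e ∪ ⁅ e ⁆ ∣
    extend e _ ih = begin
      ∣ neighbours (Z ∪ ⁅ e ⁆) ∣    ≤⟨ p⊆q⇒∣p∣≤∣q∣ split ⟩
      ∣ neighbours Z ∪ D e ∣        ≤⟨ ∣p∪q∣≤∣p∣+∣q∣ (neighbours Z) (D e) ⟩
      ∣ neighbours Z ∣ ℕ.+ ∣ D e ∣  ≤⟨ ℕ.+-mono-≤ ih (∣D∣≤d e) ⟩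
      d * ∣ Z ∣ ℕ.+ d               ≡⟨ ℕ.+-comm (d * ∣ Z ∣) d ⟩
      d ℕ.+ d * ∣ Z ∣               ≡⟨ ℕ.*-suc d ∣ Z ∣ ⟨
      d * suc ∣ Z ∣                 ≡⟨ cong (d *_) (∣p∪⁅x⁆∣≡1+∣p∣ (x∉p∩Above[x] {p = X})) ⟨
      d * ∣ Z ∪ ⁅ e ⁆ ∣             ∎
      where
      open ℕ.≤-Reasoning
      Z = X ∩ Above e
      split : neighbours (Z ∪ ⁅ e ⁆) ⊆ neighbours Z ∪ D e
      split y∈ with ∈-neighbours⁻ y∈
      ... | x , x∈ , y∈Dx with x∈p∪q⁻ Z ⁅ e ⁆ x∈
      ...   | inj₁ x∈Z   = x∈p∪q⁺ (inj₁ (∈-neighbours⁺ x∈Z y∈Dx))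
      ...   | inj₂ x∈⁅e⁆ = x∈p∪q⁺ (inj₂ (subst (λ x → _ ∈ D x) (x∈⁅y⁆⇒x≡y e x∈⁅e⁆) y∈Dx))

-- Matroid augmentation

module _ (M : Matroid n) where
  open Matroid M

  Augments : Subset n → Subset n → Subset n → Set
  Augments A O B = B ⊆ O × (∀ {x} → x ∈ B → x ∉ A) × Indep (A ∪ B)

  Augments-∪⁅⁆ : ∀ {A O B} → Augments A O B → x ∈ O → x ∉ A ∪ B → Indep ((A ∪ B) ∪ ⁅ x ⁆) →
                 Augments A O (B ∪ ⁅ x ⁆)
  Augments-∪⁅⁆ {x = x} {A} {O} {B} (B⊆O , B∩A=∅ , _) x∈O x∉A∪B indA∪B∪x =
    ∪-lub B⊆O (⁅x⁆⊆p x∈O) ,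
    (λ y∈ → [ B∩A=∅ , (λ y∈⁅x⁆ y∈A → x∉A∪B (p⊆p∪q B (subst (_∈ A) (x∈⁅y⁆⇒x≡y x y∈⁅x⁆) y∈A))) ]′
              (x∈p∪q⁻ B ⁅ x ⁆ y∈)) ,
    subst Indep (∪-assoc A B ⁅ x ⁆) indA∪B∪x

  augment : ∀ {A O} → Indep A → Indep O → ∃ λ B → Augments A O B × ∣ O ∣ ℕ.≤ ∣ A ∪ B ∣
  augment {A} {O} indA indO =
    grow ∣ O ∣ ⊥ ((λ x∈⊥ → contradiction x∈⊥ ∉⊥) , (λ x∈⊥ → contradiction x∈⊥ ∉⊥) ,
                  subst Indep (sym (∪-identityʳ A)) indA)
         (ℕ.m≤m+n ∣ O ∣ _)
    where
    grow : ∀ m B → Augments A O B → ∣ O ∣ ℕ.≤ m ℕ.+ ∣ A ∪ B ∣ → ∃ λ B → Augments A O B × ∣ O ∣ ℕ.≤ ∣ A ∪ B ∣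
    grow ℕ.zero  B aug O≤ = B , aug , O≤
    grow (suc m) B aug O≤ with ∣ A ∪ B ∣ ℕ.<? ∣ O ∣
    ... | no  A∪B≮O = B , aug , ℕ.≮⇒≥ A∪B≮O
    ... | yes A∪B<O =
      let x , x∈O , x∉A∪B , indA∪B∪x = exchange (A ∪ B) O (proj₂ (proj₂ aug)) indO A∪B<O
      in grow m (B ∪ ⁅ x ⁆) (Augments-∪⁅⁆ aug x∈O x∉A∪B indA∪B∪x) (begin
           ∣ O ∣                          ≤⟨ O≤ ⟩
           suc m ℕ.+ ∣ A ∪ B ∣            ≡⟨ ℕ.+-suc m _ ⟨
           m ℕ.+ suc ∣ A ∪ B ∣            ≡⟨ cong (m ℕ.+_) (∣p∪⁅x⁆∣≡1+∣p∣ x∉A∪B) ⟨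
           m ℕ.+ ∣ (A ∪ B) ∪ ⁅ x ⁆ ∣      ≡⟨ cong (λ C → m ℕ.+ ∣ C ∣) (∪-assoc A B ⁅ x ⁆) ⟩
           m ℕ.+ ∣ A ∪ B ∪ ⁅ x ⁆ ∣        ∎)
      where open ℕ.≤-Reasoning

-- Algorithm 1

module Runs (M : Matroid n) (f : SetFun n) (τ : ℚ) where
  open Matroid M

  Rejects : Subset n → Fin n → Set
  Rejects S x = ¬ ∃ (ValidD M f τ S x)

  Run-⊆ : Run M f τ us p q → p ⊆ q
  Run-⊆ done                    = id
  Run-⊆ (step (accept D _) run) = Run-⊆ run ∘ p⊆p∪q (D ∪ ⁅ _ ⁆)
  Run-⊆ (step (skip _) run)     = Run-⊆ run

  Run-indep : Run M f τ us p q → Indep p → Indep q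
  Run-indep done                                indp = indp
  Run-indep (step (accept _ (_ , _ , ind)) run) _    = Run-indep run ind
  Run-indep (step (skip _) run)                 indp = Run-indep run indp

  Run-⊆Above : All (x Fin.<_) us → Run M f τ us p q → q ⊆ p ∪ Above x
  Run-⊆Above _ done = p⊆p∪q _
  Run-⊆Above {x = x} {p = p} (x<u All.∷ x<us) (step {u} (accept D (valid , _)) run) =
    ⊆-trans (Run-⊆Above x<us run) (∪-lub (∪-lub (p⊆p∪q _) (q⊆p∪q p _ ∘ accepted⊆Above)) (q⊆p∪q p _))
    where
    accepted⊆Above : D ∪ ⁅ u ⁆ ⊆ Above x
    accepted⊆Above = ∪-lub (λ v∈D → ∈-Above⁺ (ℕ.<-trans x<u (proj₂ (valid _ v∈D))))
                           (⁅x⁆⊆p (∈-Above⁺ x<u))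
  Run-⊆Above (_ All.∷ x<us) (step (skip _) run) = Run-⊆Above x<us run

  Run-rejects : AllPairs Fin._<_ us → x List.∈ us → Run M f τ us p q → x ∉ q →
                ∃ λ r → Rejects r x × r ⊆ q × q ⊆ r ∪ Above x
  Run-rejects _ (Any.here refl) (step {u} (accept D _) run) x∉q =
    contradiction (Run-⊆ run (q⊆p∪q _ _ (q⊆p∪q D ⁅ u ⁆ (x∈⁅x⁆ u)))) x∉q
  Run-rejects {p = p} (x<us AllPairs.∷ _) (Any.here refl) (step (skip rejected) run) _ =
    p , rejected , Run-⊆ run , Run-⊆Above x<us run
  Run-rejects (_ AllPairs.∷ sorted) (Any.there x∈us) (step _ run) x∉q = Run-rejects sorted x∈us run x∉q

  module _ (D⁺ : Fin n → Subset n) (D⁺-complete : ∀ {x y} → DPlus f x y → y ∈ D⁺ x)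
           (D⁺-sound : ∀ {x y} → y ∈ D⁺ x → DPlus f x y) where

    -- E is an admissible D for x in state C, and what S ∪ Z adds to E ∪ C lies outside D⁺(x).
    rejected-marg<τ : ∀ {C S Z} → Rejects C x → C ⊆ S → S ⊆ C ∪ Above x → Z ⊆ Above x →
                      Indep ((S ∪ Z) ∪ ⁅ x ⁆) → marg f x (S ∪ Z) < τ
    rejected-marg<τ {x} {C} {S} {Z} rejected C⊆S S⊆C∪Above Z⊆Above indS∪Z∪x =
      ℚ.≤-<-trans (marg-antitone f E∪C⊆S∪Z outside-D⁺) (ℚ.≰⇒> λ τ≤ → rejected (E , E-valid , τ≤ , indC∪E∪x))
      where
      E : Subset n
      E = (S ∪ Z) ∩ (D⁺ x ∩ Above x)

      E⊆S∪Z : E ⊆ S ∪ Z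
      E⊆S∪Z = p∩q⊆p (S ∪ Z) _

      E-valid : ∀ v → v ∈ E → DPlus f x v × x Fin.< v
      E-valid v v∈E = let v∈D⁺ , v∈Above = x∈p∩q⁻ (D⁺ x) (Above x) (proj₂ (x∈p∩q⁻ (S ∪ Z) _ v∈E))
                      in D⁺-sound v∈D⁺ , ∈-Above⁻ v∈Above

      E∪C⊆S∪Z : E ∪ C ⊆ S ∪ Z
      E∪C⊆S∪Z = ∪-lub E⊆S∪Z (p⊆p∪q Z ∘ C⊆S)

      outside-D⁺ : ∀ {v} → v ∈ S ∪ Z → v ∉ E ∪ C → ¬ DPlus f x v
      outside-D⁺ v∈S∪Z v∉E∪C gain
        with x∈p∪q⁻ C (Above x) (∪-lub S⊆C∪Above (q⊆p∪q C (Above x) ∘ Z⊆Above) v∈S∪Z)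
      ... | inj₁ v∈C     = v∉E∪C (q⊆p∪q E C v∈C)
      ... | inj₂ v∈Above = v∉E∪C (p⊆p∪q C (x∈p∩q⁺ (v∈S∪Z , x∈p∩q⁺ (D⁺-complete gain , v∈Above))))

      indC∪E∪x : Indep (C ∪ E ∪ ⁅ x ⁆)
      indC∪E∪x = indep-⊆ _ _ (∪-lub (p⊆p∪q ⁅ x ⁆ ∘ p⊆p∪q Z ∘ C⊆S)
                                (∪-lub (p⊆p∪q ⁅ x ⁆ ∘ E⊆S∪Z) (q⊆p∪q (S ∪ Z) ⁅ x ⁆)))
                           indS∪Z∪x

    unselected-marg<τ : ∀ {S Z} → Run M f τ (allFin n) ⊥ S → x ∉ S → Z ⊆ Above x →
                        Indep ((S ∪ Z) ∪ ⁅ x ⁆) → marg f x (S ∪ Z) < τ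
    unselected-marg<τ {x} output x∉S =
      let _ , rejected , C⊆S , S⊆C∪Above = Run-rejects (tabulate⁺-< id) (∈-allFin x) output x∉S
      in rejected-marg<τ rejected C⊆S S⊆C∪Above

-- The exchange argument

module Telescope (f : SetFun n) (S X Y : Subset n) (c : ℕ) (τ : ℚ) where

  Inv : Subset n → Set
  Inv Z = (c * ∣ Z ∩ X ∣) · τ + f (S ∪ Z) ≤ f S + f Z + ∣ Z ∩ Y ∣ · τ

  Inv-⊥ : 0ℚ ≤ f ⊥ → Inv ⊥
  Inv-⊥ 0≤f⊥ = begin
    (c * ∣ ⊥ ∩ X ∣) · τ + f (S ∪ ⊥)  ≡⟨ cong₂ _+_ (cong (λ k → (c * k) · τ) (∣⊥∩p∣≡0 X))
                                                   (cong f (∪-identityʳ S)) ⟩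
    (c * 0) · τ + f S                ≡⟨ cong (λ k → k · τ + f S) (ℕ.*-zeroʳ c) ⟩
    0ℚ + f S                         ≡⟨ solve 1 (λ x → con 0ℚ :+ x := x :+ con 0ℚ :+ con 0ℚ) refl (f S) ⟩
    f S + 0ℚ + 0ℚ                    ≤⟨ ℚ.+-mono-≤ (ℚ.+-monoʳ-≤ (f S) 0≤f⊥)
                                                   (ℚ.≤-reflexive (sym (cong (_· τ) (∣⊥∩p∣≡0 Y)))) ⟩
    f S + f ⊥ + ∣ ⊥ ∩ Y ∣ · τ        ∎
    where
    open ℚ.≤-Reasoning
    open +-*-Solver

  Inv-extend : ∀ {e Z} → e ∉ Z →
               (c * ∣ ⁅ e ⁆ ∩ X ∣) · τ + marg f e (S ∪ Z) ≤ marg f e Z + ∣ ⁅ e ⁆ ∩ Y ∣ · τ →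
               Inv Z → Inv (Z ∪ ⁅ e ⁆)
  Inv-extend {e} {Z} e∉Z gain inv = subst₂ _≤_
    (cong₂ _+_ X-count (cong f (∪-assoc S Z ⁅ e ⁆)))
    (cong (_+_ (f S + f (Z ∪ ⁅ e ⁆))) Y-count)
    (telescope-step a (f (S ∪ Z)) (f S) (f Z) b δa (f ((S ∪ Z) ∪ ⁅ e ⁆)) (f (Z ∪ ⁅ e ⁆)) δb inv gain)
    where
    a  = (c * ∣ Z ∩ X ∣) · τ
    δa = (c * ∣ ⁅ e ⁆ ∩ X ∣) · τ
    b  = ∣ Z ∩ Y ∣ · τ
    δb = ∣ ⁅ e ⁆ ∩ Y ∣ · τ
    X-count : a + δa ≡ (c * ∣ (Z ∪ ⁅ e ⁆) ∩ X ∣) · τ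
    X-count = trans (sym (×-homo-+ τ (c * ∣ Z ∩ X ∣) _))
                (cong (_· τ) (trans (sym (ℕ.*-distribˡ-+ c _ _))
                  (cong (c *_) (sym (∣[p∪⁅x⁆]∩q∣≡∣p∩q∣+∣⁅x⁆∩q∣ e∉Z X)))))
    Y-count : b + δb ≡ ∣ (Z ∪ ⁅ e ⁆) ∩ Y ∣ · τ
    Y-count = trans (sym (×-homo-+ τ ∣ Z ∩ Y ∣ _)) (cong (_· τ) (sym (∣[p∪⁅x⁆]∩q∣≡∣p∩q∣+∣⁅x⁆∩q∣ e∉Z Y)))

t*2+d*s≤7*t′ : ∀ t t′ s d → t ℕ.≤ t′ ℕ.+ (s ℕ.+ d * s) → 2 * suc d * s ℕ.< t →
               t * 2 ℕ.+ d * s ℕ.≤ 7 * t′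
t*2+d*s≤7*t′ t t′ s d t≤ small = ℕ.+-cancelʳ-≤ (7 * k) _ _ (begin
  t * 2 ℕ.+ d * s ℕ.+ 7 * k  ≤⟨ ℕ.+-monoˡ-≤ (7 * k) (ℕ.+-monoʳ-≤ (t * 2) (ℕ.m≤n+m (d * s) s)) ⟩
  t * 2 ℕ.+ k ℕ.+ 7 * k      ≡⟨ solve 2 (λ t k → t :* con 2 :+ k :+ con 7 :* k := t :* con 2 :+ con 8 :* k)
                                  refl t k ⟩
  t * 2 ℕ.+ 8 * k            ≤⟨ ℕ.+-monoʳ-≤ (t * 2) 8k≤5t ⟩
  t * 2 ℕ.+ 5 * t            ≡⟨ solve 1 (λ t → t :* con 2 :+ con 5 :* t := con 7 :* t) refl t ⟩
  7 * t                      ≤⟨ ℕ.*-monoʳ-≤ 7 t≤ ⟩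
  7 * (t′ ℕ.+ k)             ≡⟨ ℕ.*-distribˡ-+ 7 t′ k ⟩
  7 * t′ ℕ.+ 7 * k           ∎)
  where
  open ℕ.≤-Reasoning
  open ℕ-Solver.+-*-Solver
  k = s ℕ.+ d * s
  8k≤5t : 8 * k ℕ.≤ 5 * t
  8k≤5t = begin
    8 * k            ≤⟨ ℕ.m≤m+n (8 * k) (2 * k) ⟩
    8 * k ℕ.+ 2 * k  ≡⟨ solve 1 (λ k → con 8 :* k :+ con 2 :* k := con 5 :* (con 2 :* k)) refl k ⟩
    5 * (2 * k)      ≤⟨ ℕ.*-monoʳ-≤ 5 (ℕ.<⇒≤ (subst (ℕ._< t) (ℕ.*-assoc 2 (suc d) s) small)) ⟩
    5 * t            ∎

module Exchange
  (M : Matroid n) (f : SetFun n) (τ : ℚ) (D⁺ : Fin n → Subset n)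
  (D⁺-complete : ∀ {x y} → DPlus f x y → y ∈ D⁺ x) (D⁺-sound : ∀ {x y} → y ∈ D⁺ x → DPlus f x y)
  {d} (∣D⁺∣≤d : ∀ x → ∣ D⁺ x ∣ ℕ.≤ d) (nonNeg : NonNeg f) (mono : Monotone f) (0≤τ : 0ℚ ≤ τ)
  {S OPT : Subset n} (output : Run M f τ (allFin n) ⊥ S)
  {B : Subset n} (B⊆OPT : B ⊆ OPT) (B∩S=∅ : ∀ {x} → x ∈ B → x ∉ S) (indS∪B : Matroid.Indep M (S ∪ B))
  (∣OPT∣≤∣S∪B∣ : ∣ OPT ∣ ℕ.≤ ∣ S ∪ B ∣)
  where

  open Matroid M
  open Runs M f τ
  open Neighbourhood D⁺

  missing? : Decidable (λ v → v ∈ OPT × v ∉ B)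
  missing? v = v ∈? OPT ×-dec ¬? (v ∈? B)

  Missing : Subset n
  Missing = subset missing?

  ∣Missing∣≤∣S∣ : ∣ Missing ∣ ℕ.≤ ∣ S ∣
  ∣Missing∣≤∣S∣ = ℕ.+-cancelʳ-≤ ∣ B ∣ _ _ (begin
    ∣ Missing ∣ ℕ.+ ∣ B ∣  ≡⟨ ∣p∪q∣≡∣p∣+∣q∣ Missing B (proj₂ ∘ ∈-subset⁻ missing?) ⟨
    ∣ Missing ∪ B ∣        ≤⟨ p⊆q⇒∣p∣≤∣q∣ (∪-lub (proj₁ ∘ ∈-subset⁻ missing?) B⊆OPT) ⟩
    ∣ OPT ∣                ≤⟨ ∣OPT∣≤∣S∪B∣ ⟩
    ∣ S ∪ B ∣              ≤⟨ ∣p∪q∣≤∣p∣+∣q∣ S B ⟩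
    ∣ S ∣ ℕ.+ ∣ B ∣        ∎)
    where open ℕ.≤-Reasoning

  -- For a settled u, the elements of OPT after u that u depends on all lie in B, so that
  -- w(u) ≤ f(u | B ∩ Above u).
  settled? : Decidable (λ u → u ∈ B × ¬ Nonempty (D⁺ u ∩ Missing))
  settled? u = u ∈? B ×-dec ¬? (nonempty? (D⁺ u ∩ Missing))

  Settled : Subset n
  Settled = subset settled?

  module _ {T : Subset n} (T⊆OPT : T ⊆ OPT) (T-heavy : ∀ {x} → x ∈ T → 8 · τ ≤ weight f OPT x) where

    T-covered : T ⊆ T ∩ Settled ∪ Missing ∪ neighbours Missing
    T-covered {u} u∈T with u ∈? B
    ... | no u∉B = q⊆p∪q (T ∩ Settled) _ (p⊆p∪q _ (∈-subset⁺ missing? (T⊆OPT u∈T , u∉B)))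
    ... | yes u∈B with nonempty? (D⁺ u ∩ Missing)
    ...   | no  none         = p⊆p∪q _ (x∈p∩q⁺ (u∈T , ∈-subset⁺ settled? (u∈B , none)))
    ...   | yes (v , v∈D⁺∩M) =
      let v∈D⁺ , v∈M = x∈p∩q⁻ (D⁺ u) Missing v∈D⁺∩M
      in q⊆p∪q (T ∩ Settled) _ (q⊆p∪q Missing _ (∈-neighbours⁺ v∈M (D⁺-complete (DPlus-sym f (D⁺-sound v∈D⁺)))))

    ∣T∣≤ : ∣ T ∣ ℕ.≤ ∣ T ∩ Settled ∣ ℕ.+ (∣ S ∣ ℕ.+ d * ∣ S ∣)
    ∣T∣≤ = begin
      ∣ T ∣                                                   ≤⟨ p⊆q⇒∣p∣≤∣q∣ T-covered ⟩
      ∣ T ∩ Settled ∪ Missing ∪ neighbours Missing ∣          ≤⟨ ∣p∪q∣≤∣p∣+∣q∣ (T ∩ Settled) _ ⟩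
      ∣ T ∩ Settled ∣ ℕ.+ ∣ Missing ∪ neighbours Missing ∣    ≤⟨ ℕ.+-monoʳ-≤ ∣ T ∩ Settled ∣
                                                                   (∣p∪q∣≤∣p∣+∣q∣ Missing _) ⟩
      ∣ T ∩ Settled ∣ ℕ.+ (∣ Missing ∣ ℕ.+ ∣ neighbours Missing ∣)
        ≤⟨ ℕ.+-monoʳ-≤ ∣ T ∩ Settled ∣ (ℕ.+-mono-≤ ∣Missing∣≤∣S∣
             (ℕ.≤-trans (∣neighbours∣≤ ∣D⁺∣≤d Missing) (ℕ.*-monoʳ-≤ d ∣Missing∣≤∣S∣))) ⟩
      ∣ T ∩ Settled ∣ ℕ.+ (∣ S ∣ ℕ.+ d * ∣ S ∣)               ∎
      where open ℕ.≤-Reasoning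

    open Telescope f S (T ∩ Settled) (neighbours S) 7 τ

    module _ {e} (e∈B : e ∈ B) where

      Z : Subset n
      Z = B ∩ Above e

      marg<τ : marg f e (S ∪ Z) < τ
      marg<τ = unselected-marg<τ D⁺ D⁺-complete D⁺-sound output (B∩S=∅ e∈B) (p∩q⊆q B (Above e))
        (indep-⊆ _ _ (∪-lub (∪-lub (p⊆p∪q B) (q⊆p∪q S B ∘ p∩q⊆p B (Above e))) (q⊆p∪q S B ∘ ⁅x⁆⊆p e∈B)) indS∪B)

      settled-gain : e ∈ T ∩ Settled → 7 · τ + marg f e (S ∪ Z) ≤ marg f e Z
      settled-gain e∈T′ = begin
        7 · τ + marg f e (S ∪ Z)  ≤⟨ ℚ.+-monoʳ-≤ (7 · τ) (ℚ.<⇒≤ marg<τ) ⟩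
        7 · τ + τ                 ≡⟨ ℚ.+-comm (7 · τ) τ ⟩
        8 · τ                     ≤⟨ T-heavy (p∩q⊆p T Settled e∈T′) ⟩
        weight f OPT e            ≡⟨ cong (λ N → marg f e (OPT ∩ N)) (NotArrivedBy≡Above e) ⟩
        marg f e (OPT ∩ Above e)  ≤⟨ marg-antitone f Z⊆OPT∩Above later-independent ⟩
        marg f e Z                ∎
        where
        open ℚ.≤-Reasoning
        Z⊆OPT∩Above : Z ⊆ OPT ∩ Above e
        Z⊆OPT∩Above v∈Z = let v∈B , v∈Above = x∈p∩q⁻ B (Above e) v∈Z in x∈p∩q⁺ (B⊆OPT v∈B , v∈Above)
        later-independent : ∀ {v} → v ∈ OPT ∩ Above e → v ∉ Z → ¬ DPlus f e v
        later-independent {v} v∈ v∉Z gain =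
          let v∈OPT , v∈Above = x∈p∩q⁻ OPT (Above e) v∈
              v∈Missing = ∈-subset⁺ missing? (v∈OPT , λ v∈B → v∉Z (x∈p∩q⁺ (v∈B , v∈Above)))
          in proj₂ (∈-subset⁻ settled? (p∩q⊆q T Settled e∈T′)) (v , x∈p∩q⁺ (D⁺-complete gain , v∈Missing))

      neighbour-gain : marg f e (S ∪ Z) ≤ marg f e Z + τ
      neighbour-gain = ℚ.≤-trans (ℚ.<⇒≤ marg<τ)
        (subst (_≤ marg f e Z + τ) (ℚ.+-identityˡ τ) (ℚ.+-monoˡ-≤ τ (marg-nonNeg f mono e Z)))

      non-neighbour-gain : e ∉ neighbours S → marg f e (S ∪ Z) ≤ marg f e Z
      non-neighbour-gain e∉N = marg-antitone f (q⊆p∪q S Z) λ v∈S∪Z v∉Z gain →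
        let v∈S = [ id , (λ v∈Z → contradiction v∈Z v∉Z) ]′ (x∈p∪q⁻ S Z v∈S∪Z)
        in e∉N (∈-neighbours⁺ v∈S (D⁺-complete (DPlus-sym f gain)))

      gain : (7 * ∣ ⁅ e ⁆ ∩ T ∩ Settled ∣) · τ + marg f e (S ∪ Z) ≤ marg f e Z + ∣ ⁅ e ⁆ ∩ neighbours S ∣ · τ
      gain with e ∈? T ∩ Settled | e ∈? neighbours S
      ... | yes e∈T′ | _ rewrite ∣⁅x⁆∩p∣≡1 e∈T′ =
        ℚ.≤-trans (settled-gain e∈T′) (p≤p+q (·-nonNeg ∣ ⁅ e ⁆ ∩ neighbours S ∣ 0≤τ))
      ... | no e∉T′ | yes e∈N rewrite ∣⁅x⁆∩p∣≡0 e∉T′ | ∣⁅x⁆∩p∣≡1 e∈N =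
        subst₂ _≤_ (sym (ℚ.+-identityˡ _)) (cong (_+_ (marg f e Z)) (sym (ℚ.+-identityʳ τ))) neighbour-gain
      ... | no e∉T′ | no e∉N rewrite ∣⁅x⁆∩p∣≡0 e∉T′ | ∣⁅x⁆∩p∣≡0 e∉N =
        subst₂ _≤_ (sym (ℚ.+-identityˡ _)) (sym (ℚ.+-identityʳ _)) (non-neighbour-gain e∉N)

    7∣T∩Settled∣τ≤ : (7 * ∣ T ∩ Settled ∣) · τ ≤ f S + (d * ∣ S ∣) · τ
    7∣T∩Settled∣τ≤ = +-cancelʳ-≤ _ _ (f (S ∪ B)) (begin
      (7 * ∣ T ∩ Settled ∣) · τ + f (S ∪ B)
        ≤⟨ ℚ.+-monoˡ-≤ (f (S ∪ B)) (·-monoˡ-≤ 0≤τ (ℕ.*-monoʳ-≤ 7 (p⊆q⇒∣p∣≤∣q∣ T∩Settled⊆B∩T∩Settled))) ⟩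
      (7 * ∣ B ∩ T ∩ Settled ∣) · τ + f (S ∪ B)
        ≤⟨ ∩-Above-ind Inv B (Inv-⊥ (nonNeg ⊥)) (λ e e∈B → Inv-extend x∉p∩Above[x] (gain e∈B)) ⟩
      f S + f B + ∣ B ∩ neighbours S ∣ · τ
        ≤⟨ ℚ.+-mono-≤ (ℚ.+-monoʳ-≤ (f S) (mono B (S ∪ B) (q⊆p∪q S B)))
                      (·-monoˡ-≤ 0≤τ (ℕ.≤-trans (∣p∩q∣≤∣q∣ B _) (∣neighbours∣≤ ∣D⁺∣≤d S))) ⟩
      f S + f (S ∪ B) + (d * ∣ S ∣) · τ
        ≡⟨ solve 3 (λ a b c → a :+ b :+ c := a :+ c :+ b) refl (f S) (f (S ∪ B)) _ ⟩
      f S + (d * ∣ S ∣) · τ + f (S ∪ B)  ∎)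
      where
      open ℚ.≤-Reasoning
      open +-*-Solver
      T∩Settled⊆B∩T∩Settled : T ∩ Settled ⊆ B ∩ T ∩ Settled
      T∩Settled⊆B∩T∩Settled u∈ = x∈p∩q⁺ (proj₁ (∈-subset⁻ settled? (p∩q⊆q T Settled u∈)) , u∈)

    2∣T∣τ≤f[S] : 2 * suc d * ∣ S ∣ ℕ.< ∣ T ∣ → (∣ T ∣ * 2) · τ ≤ f S
    2∣T∣τ≤f[S] small = +-cancelʳ-≤ _ _ ((d * ∣ S ∣) · τ) (begin
      (∣ T ∣ * 2) · τ + (d * ∣ S ∣) · τ  ≡⟨ ×-homo-+ τ (∣ T ∣ * 2) (d * ∣ S ∣) ⟨
      (∣ T ∣ * 2 ℕ.+ d * ∣ S ∣) · τ      ≤⟨ ·-monoˡ-≤ 0≤τ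
                                             (t*2+d*s≤7*t′ (∣ T ∣) (∣ T ∩ Settled ∣) (∣ S ∣) d ∣T∣≤ small) ⟩
      (7 * ∣ T ∩ Settled ∣) · τ          ≤⟨ 7∣T∩Settled∣τ≤ ⟩
      f S + (d * ∣ S ∣) · τ              ∎)
      where open ℚ.≤-Reasoning

lemma3 : ∀ {n} (f : SetFun n) (M : Matroid n) (k d : ℕ) (OPT : Subset n)
           (α optα : ℚ) (p : ℤ) (S : Subset n) →
         f Data.Fin.Subset.⊥ ≡ 0ℚ → NonNeg f → Monotone f →
         HasRank M k → IsOPT M f OPT → IsSupDegree f d →
         1ℚ ≤ α → f OPT ≤ α ℚ.* optα → optα ≤ f OPT →
         (∀ a b → IsCeilLog2 (+ k / 1) a → IsCeilLog2 α b →
            (ℤ.- a ℤ.- + 3) ℤ.≤ p × p ℤ.≤ b) →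
         Output M f optα p S →
         2 * suc d * ∣ S ∣ ℕ.< ∣ OPTp f OPT optα (p ℤ.+ + 3) ∣ →
         sumOver (OPTp f OPT optα (p ℤ.+ + 3)) (weight f OPT) ℚ.* (+ 1 / 8) ≤ f S
lemma3 f M _ d OPT _ optα p S _ nonNeg mono _ (indOPT , _) (D⁺ , D⁺-spec , d≡max) 1≤α fOPT≤αoptα _ _
       output small =
  let B , (B⊆OPT , B∩S=∅ , indS∪B) , ∣OPT∣≤∣S∪B∣ = augment M (Run-indep output indep-⊥) indOPT
      open Exchange M f τ D⁺ (proj₂ (D⁺-spec _ _)) (proj₁ (D⁺-spec _ _)) ∣D⁺∣≤d nonNeg mono 0≤τ output
                    B⊆OPT B∩S=∅ indS∪B ∣OPT∣≤∣S∪B∣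
  in begin
    sumOver T w ℚ.* (+ 1 / 8)   ≤⟨ ℚ.*-monoʳ-≤-nonNeg (+ 1 / 8) (sumOver-≤ T w (proj₂ ∘ proj₂ ∘ ∈-T⁻)) ⟩
    (∣ T ∣ · U) ℚ.* (+ 1 / 8)   ≡⟨ ×-assoc-* ∣ T ∣ U (+ 1 / 8) ⟩
    ∣ T ∣ · (U ℚ.* (+ 1 / 8))   ≡⟨ cong (∣ T ∣ ·_) (upper-threshold/8 p optα) ⟩
    ∣ T ∣ · (2 · τ)             ≡⟨ ×-assocˡ τ ∣ T ∣ 2 ⟩
    (∣ T ∣ * 2) · τ             ≤⟨ 2∣T∣τ≤f[S] (proj₁ ∘ ∈-T⁻) T-heavy small ⟩
    f S                         ∎
  where
  open ℚ.≤-Reasoning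
  open Matroid M using (indep-⊥)
  τ = pow2 p ℚ.* optα ℚ.* ½
  open Runs M f τ using (Run-indep)
  T = OPTp f OPT optα (p ℤ.+ + 3)
  w = weight f OPT
  U = pow2 (p ℤ.+ + 3) ℚ.* optα
  ∈-T⁻ = ∈-OPTp⁻ f OPT optα (p ℤ.+ + 3)
  T-heavy : ∀ {x} → x ∈ T → 8 · τ ≤ w x
  T-heavy x∈T = subst (_≤ w _) (lower-threshold p optα) (proj₁ (proj₂ (∈-T⁻ x∈T)))
  0≤τ : 0ℚ ≤ τ
  0≤τ = *-nonNeg (*-nonNeg (pow2-nonNeg p) (estimate-nonNeg 1≤α (nonNeg OPT) fOPT≤αoptα)) (ℚ.nonNegative⁻¹ ½)
  ∣D⁺∣≤d : ∀ x → ∣ D⁺ x ∣ ℕ.≤ d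
  ∣D⁺∣≤d x = subst (∣ D⁺ x ∣ ℕ.≤_) (sym d≡max) (≤-maxList (∈-map⁺ (λ u → ∣ D⁺ u ∣) (∈-allFin x)))
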